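{- Let $A\in GL_n(\mathbb{F}_q)$ and $B\in GL_m(\mathbb{F}_q)$, and let $A\oplus B=\begin{pmatrix}A&0\\0&B\end{pmatrix}\in GL_{n+m}(\mathbb{F}_q)$. Then $$\mathrm{Im}(\partial\mathrm{char}_{A\oplus B})=\mathrm{span}_{\mathbb{F}_q}\big(\mathrm{char}(B)\cdot\mathrm{Im}(\partial\mathrm{char}_A),\ \mathrm{char}(A)\cdot\mathrm{Im}(\partial\mathrm{char}_B)\big).$$
   Context: $q$ is a power of an odd prime. For $C\in GL_N(\mathbb{F}_q)$, $\mathrm{char}(C)=\det(xI-C)$, and $\partial\mathrm{char}_C:M_N(\mathbb{F}_q)\to\mathbb{F}_q[x]$ is the $\mathbb{F}_q$-linear map $C_1\mapsto\mathrm{tr}\big(\mathrm{Adj}(xI-C)\,C\,C_1\big)$, where $\mathrm{Adj}$ denotes the adjugate matrix (with entries in $\mathbb{F}_q[x]$). -}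

module Defs where

open import Level using (_⊔_)
open import Algebra.Bundles using (CommutativeRing)
open import Data.Nat using (ℕ; zero; suc) renaming (_+_ to _+ℕ_)
open import Data.Fin using (Fin; zero; suc; toℕ; punchIn; splitAt)
import Data.Fin as Fin
open import Data.List using (List; []; _∷_; map; foldr)
open import Data.List.Relation.Unary.Any using (Any)
open import Data.List.Relation.Unary.All using (All)
open import Data.Product using (Σ; ∃; _×_; _,_; proj₁; proj₂)
open import Data.Sum using (_⊎_; inj₁; inj₂)
open import Relation.Nullary using (¬_; does)
open import Data.Bool using (if_then_else_)

module _ {c ℓ} (F : CommutativeRing c ℓ) where
  open CommutativeRing F using (_≈_; _+_; _*_; -_; 0#; 1#) renaming (Carrier to K)

  record IsFiniteFieldOddChar : Set (c ⊔ ℓ) where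
    field
      nontrivial : ¬ (1# ≈ 0#)
      inverse    : ∀ x → ¬ (x ≈ 0#) → ∃ λ y → x * y ≈ 1#
      elements   : List K
      finite     : ∀ x → Any (x ≈_) elements
      oddChar    : ¬ (1# + 1# ≈ 0#)

  -- Polynomials over F: coefficient lists, constant term first.
  Poly : Set c
  Poly = List K

  coeff : Poly → ℕ → K
  coeff []      _       = 0#
  coeff (a ∷ p) zero    = a
  coeff (a ∷ p) (suc k) = coeff p k

  -- equality of polynomials: equal coefficients (trailing zeros irrelevant)
  _≈ₚ_ : Poly → Poly → Set ℓ
  p ≈ₚ q = ∀ k → coeff p k ≈ coeff q k

  _+ₚ_ : Poly → Poly → Poly
  []      +ₚ q       = q
  (a ∷ p) +ₚ []      = a ∷ p
  (a ∷ p) +ₚ (b ∷ q) = (a + b) ∷ (p +ₚ q)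

  scaleₚ : K → Poly → Poly
  scaleₚ a p = map (a *_) p

  negₚ : Poly → Poly
  negₚ p = map (-_) p

  _*ₚ_ : Poly → Poly → Poly
  []      *ₚ q = []
  (a ∷ p) *ₚ q = scaleₚ a q +ₚ (0# ∷ (p *ₚ q))

  0ₚ 1ₚ : Poly
  0ₚ = []
  1ₚ = 1# ∷ []

  constₚ : K → Poly
  constₚ a = a ∷ []

  signₚ : ℕ → Poly → Poly
  signₚ zero    p = p
  signₚ (suc k) p = negₚ (signₚ k p)

  sumₚ : ∀ {n} → (Fin n → Poly) → Poly
  sumₚ {zero}  f = 0ₚ
  sumₚ {suc n} f = f zero +ₚ sumₚ (λ i → f (suc i))

  sumK : ∀ {n} → (Fin n → K) → K
  sumK {zero}  f = 0#
  sumK {suc n} f = f zero + sumK (λ i → f (suc i))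

  Mat : ℕ → Set c
  Mat n = Fin n → Fin n → K

  MatP : ℕ → Set c
  MatP n = Fin n → Fin n → Poly

  _·_ : ∀ {n} → Mat n → Mat n → Mat n
  (M · N) i j = sumK (λ k → M i k * N k j)

  I : ∀ {n} → Mat n
  I i j = if does (i Fin.≟ j) then 1# else 0#

  _≈ₘ_ : ∀ {n} → Mat n → Mat n → Set ℓ
  M ≈ₘ N = ∀ i j → M i j ≈ N i j

  Invertible : ∀ {n} → Mat n → Set (c ⊔ ℓ)
  Invertible {n} M = Σ (Mat n) λ N → ((M · N) ≈ₘ I) × ((N · M) ≈ₘ I)

  _⊕_ : ∀ {n m} → Mat n → Mat m → Mat (n +ℕ m)
  _⊕_ {n} A B i j with splitAt n i | splitAt n j
  ... | inj₁ a | inj₁ b = A a b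
  ... | inj₂ a | inj₂ b = B a b
  ... | inj₁ _ | inj₂ _ = 0#
  ... | inj₂ _ | inj₁ _ = 0#

  _·ₚ_ : ∀ {n} → MatP n → MatP n → MatP n
  (M ·ₚ N) i j = sumₚ (λ k → M i k *ₚ N k j)

  liftM : ∀ {n} → Mat n → MatP n
  liftM M i j = constₚ (M i j)

  traceP : ∀ {n} → MatP n → Poly
  traceP M = sumₚ (λ i → M i i)

  minor : ∀ {n} → Fin (suc n) → Fin (suc n) → MatP (suc n) → MatP n
  minor i j M a b = M (punchIn i a) (punchIn j b)

  detP : ∀ {n} → MatP n → Poly
  detP {zero}  M = 1ₚ
  detP {suc n} M = sumₚ (λ j → signₚ (toℕ j) (M zero j *ₚ detP (minor zero j M)))

  adjP : ∀ {n} → MatP n → MatP n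
  adjP {zero}  M () j
  adjP {suc n} M i j = signₚ (toℕ i +ℕ toℕ j) (detP (minor j i M))

  xI-C : ∀ {n} → Mat n → MatP n
  xI-C C i j = if does (i Fin.≟ j) then (- C i j) ∷ 1# ∷ [] else (- C i j) ∷ []

  charP : ∀ {n} → Mat n → Poly
  charP C = detP (xI-C C)

  dchar : ∀ {n} → Mat n → Mat n → Poly
  dchar C C₁ = traceP ((adjP (xI-C C) ·ₚ liftM C) ·ₚ liftM C₁)

  ImDChar : ∀ {n} → Mat n → Poly → Set (c ⊔ ℓ)
  ImDChar {n} C p = Σ (Mat n) λ C₁ → dchar C C₁ ≈ₚ p

  ScaledBy : Poly → (Poly → Set (c ⊔ ℓ)) → Poly → Set (c ⊔ ℓ)
  ScaledBy g S p = Σ Poly λ f → S f × (p ≈ₚ (g *ₚ f))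

  linComb : List (K × Poly) → Poly
  linComb = foldr (λ cs acc → scaleₚ (proj₁ cs) (proj₂ cs) +ₚ acc) 0ₚ

  Span : (Poly → Set (c ⊔ ℓ)) → Poly → Set (c ⊔ ℓ)
  Span S p = Σ (List (K × Poly)) λ xs → All (λ cs → S (proj₂ cs)) xs × (p ≈ₚ linComb xs)

{-# OPTIONS --safe #-}
module Submission where

-- Deleting a row and a column of xI − (A ⊕ B) inside one diagonal block leaves a block-triangular
-- matrix, whose determinant is the product of the determinants of its diagonal blocks; deleting
-- them in different blocks leaves a zero block whose height and width add up to more than the size
-- of the matrix, so the determinant vanishes. Hence Adj(xI − (A ⊕ B)) is block diagonal with blocks
-- char(B)·Adj(xI − A) and char(A)·Adj(xI − B), and taking the trace gives
--   ∂char_{A⊕B}(X) = char(B)·∂char_A(X₁₁) + char(A)·∂char_B(X₂₂),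
-- which proves ⊆. Conversely ∂char_{A⊕B} is linear and maps Y ⊕ 0 and 0 ⊕ Y to char(B)·∂char_A(Y)
-- and char(A)·∂char_B(Y).

open import Defs
open import Level using (Level; _⊔_)
open import Algebra.Bundles using (CommutativeRing; AbelianGroup)
open import Algebra.Structures using (IsAbelianGroup)
import Algebra.Properties.Ring as RingProperties
import Algebra.Properties.CommutativeSemigroup as CommutativeSemigroupProperties
open import Data.Nat using (ℕ; zero; suc; _≤_; _<_; z≤n; s≤s; _≤?_; _<?_) renaming (_+_ to _+ℕ_)
open import Data.Nat.Properties
  using (≤-refl; ≤-trans; ≤-reflexive; <-≤-trans; ≤-pred; n≤1+n; m≤m+n; m<m+n; +-suc;
         suc-injective; +-monoʳ-≤; +-monoʳ-<; ≮⇒≥; ≰⇒>; <⇒≱)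
open import Data.Fin using (Fin; zero; suc; toℕ; punchIn; splitAt; _↑ˡ_; _↑ʳ_)
import Data.Fin as Fin
open import Data.Fin.Properties
  using (toℕ-↑ˡ; toℕ-↑ʳ; toℕ<n; toℕ≤pred[n]; toℕ-injective; ↑ˡ-injective; ↑ʳ-injective;
         splitAt-↑ˡ; splitAt-↑ʳ; splitAt⁻¹-↑ˡ; splitAt⁻¹-↑ʳ)
open import Data.List using ([]; _∷_; map)
open import Data.List.Relation.Unary.All as All using ([]; _∷_)
open import Data.Product using (_×_; _,_; proj₂)
open import Data.Sum using (_⊎_; inj₁; inj₂)
open import Data.Empty using (⊥-elim)
open import Function using (_∘_)
open import Relation.Nullary using (yes; no)
open import Relation.Binary.Structures using (IsEquivalence)
open import Relation.Binary.PropositionalEquality as ≡ using (_≡_; _≢_)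
import Relation.Binary.Reasoning.Setoid as SetoidReasoning

toℕ-punchIn-< : ∀ {n} (i : Fin (suc n)) (j : Fin n) →
                toℕ j < toℕ i → toℕ (punchIn i j) ≡ toℕ j
toℕ-punchIn-< (suc i) zero    _         = ≡.refl
toℕ-punchIn-< (suc i) (suc j) (s≤s j<i) = ≡.cong suc (toℕ-punchIn-< i j j<i)

toℕ-punchIn-≥ : ∀ {n} (i : Fin (suc n)) (j : Fin n) →
                toℕ i ≤ toℕ j → toℕ (punchIn i j) ≡ suc (toℕ j)
toℕ-punchIn-≥ zero    j       _         = ≡.refl
toℕ-punchIn-≥ (suc i) (suc j) (s≤s i≤j) = ≡.cong suc (toℕ-punchIn-≥ i j i≤j)

toℕ-punchIn-≤ : ∀ {n} (i : Fin (suc n)) (j : Fin n) → toℕ (punchIn i j) ≤ suc (toℕ j)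
toℕ-punchIn-≤ zero    j       = ≤-refl
toℕ-punchIn-≤ (suc i) zero    = z≤n
toℕ-punchIn-≤ (suc i) (suc j) = s≤s (toℕ-punchIn-≤ i j)

toℕ≤toℕ-punchIn : ∀ {n} (i : Fin (suc n)) (j : Fin n) → toℕ j ≤ toℕ (punchIn i j)
toℕ≤toℕ-punchIn zero    j       = n≤1+n _
toℕ≤toℕ-punchIn (suc i) zero    = z≤n
toℕ≤toℕ-punchIn (suc i) (suc j) = s≤s (toℕ≤toℕ-punchIn i j)

toℕ-punchIn-shift : ∀ d {n n′} (i : Fin (suc n)) (j : Fin n) (i′ : Fin (suc n′)) (j′ : Fin n′) →
                    toℕ i ≡ d +ℕ toℕ i′ → toℕ j ≡ d +ℕ toℕ j′ →
                    toℕ (punchIn i j) ≡ d +ℕ toℕ (punchIn i′ j′)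
toℕ-punchIn-shift d i j i′ j′ i≡ j≡ with toℕ j′ <? toℕ i′
... | yes j′<i′ = begin
  toℕ (punchIn i j)
    ≡⟨ toℕ-punchIn-< i j (≡.subst₂ _<_ (≡.sym j≡) (≡.sym i≡) (+-monoʳ-< d j′<i′)) ⟩
  toℕ j
    ≡⟨ j≡ ⟩
  d +ℕ toℕ j′
    ≡⟨ ≡.cong (d +ℕ_) (toℕ-punchIn-< i′ j′ j′<i′) ⟨
  d +ℕ toℕ (punchIn i′ j′)
    ∎
  where open ≡.≡-Reasoning
... | no j′≮i′ = begin
  toℕ (punchIn i j)
    ≡⟨ toℕ-punchIn-≥ i j (≡.subst₂ _≤_ (≡.sym i≡) (≡.sym j≡) (+-monoʳ-≤ d (≮⇒≥ j′≮i′))) ⟩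
  suc (toℕ j)
    ≡⟨ ≡.cong suc j≡ ⟩
  suc (d +ℕ toℕ j′)
    ≡⟨ +-suc d (toℕ j′) ⟨
  d +ℕ suc (toℕ j′)
    ≡⟨ ≡.cong (d +ℕ_) (toℕ-punchIn-≥ i′ j′ (≮⇒≥ j′≮i′)) ⟨
  d +ℕ toℕ (punchIn i′ j′)
    ∎
  where open ≡.≡-Reasoning

toℕ-↑ˡ-< : ∀ {k} (i : Fin k) l → toℕ (i ↑ˡ l) < k
toℕ-↑ˡ-< zero    l = s≤s z≤n
toℕ-↑ˡ-< (suc i) l = s≤s (toℕ-↑ˡ-< i l)

≤-toℕ-↑ʳ : ∀ k {l} (j : Fin l) → k ≤ toℕ (k ↑ʳ j)
≤-toℕ-↑ʳ zero    j = z≤n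
≤-toℕ-↑ʳ (suc k) j = s≤s (≤-toℕ-↑ʳ k j)

toℕ-punchIn-↑ˡ-≥ : ∀ {k l} (i : Fin (suc k)) (j : Fin (k +ℕ l)) →
                   k ≤ toℕ j → suc k ≤ toℕ (punchIn (i ↑ˡ l) j)
toℕ-punchIn-↑ˡ-≥ {k} {l} i j k≤j = ≡.subst (suc k ≤_)
  (≡.sym (toℕ-punchIn-≥ (i ↑ˡ l) j (≤-trans (≤-pred (toℕ-↑ˡ-< i l)) k≤j))) (s≤s k≤j)

toℕ-punchIn-↑ʳ-< : ∀ {k l} (i : Fin l) (j : Fin (k +ℕ l)) →
                   toℕ j ≤ k → toℕ (punchIn (suc k ↑ʳ i) j) < suc k
toℕ-punchIn-↑ʳ-< {k} i j j≤k = ≡.subst (_< suc k)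
  (≡.sym (toℕ-punchIn-< (suc k ↑ʳ i) j (<-≤-trans (s≤s j≤k) (≤-toℕ-↑ʳ (suc k) i)))) (s≤s j≤k)

module Polynomials {c ℓ} (F : CommutativeRing c ℓ) where
  private
    module K = CommutativeRing F
    module KP = RingProperties K.ring

    infixl 6 _+_
    infixl 7 _*_
    _+_ _*_ : Poly F → Poly F → Poly F
    _+_ = _+ₚ_ F
    _*_ = _*ₚ_ F

  -- The record lets Agda infer both polynomials from a proof of their equality.
  infix 4 _≋_
  record _≋_ (p q : Poly F) : Set ℓ where
    constructor mk≋
    field ≋⇒≈ₚ : _≈ₚ_ F p q
  open _≋_ public

  ∷-cong : ∀ {a b p q} → a K.≈ b → p ≋ q → a ∷ p ≋ b ∷ q
  ∷-cong a≈b p≋q = mk≋ λ { zero → a≈b ; (suc k) → ≋⇒≈ₚ p≋q k }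

  private
    ≋-refl : ∀ {p} → p ≋ p
    ≋-refl = mk≋ λ _ → K.refl

    ≋-sym : ∀ {p q} → p ≋ q → q ≋ p
    ≋-sym p≋q = mk≋ λ k → K.sym (≋⇒≈ₚ p≋q k)

    ≋-trans : ∀ {p q r} → p ≋ q → q ≋ r → p ≋ r
    ≋-trans p≋q q≋r = mk≋ λ k → K.trans (≋⇒≈ₚ p≋q k) (≋⇒≈ₚ q≋r k)

    ≋-isEquivalence : IsEquivalence _≋_
    ≋-isEquivalence = record { refl = ≋-refl ; sym = ≋-sym ; trans = ≋-trans }

    coeff-+ : ∀ p q k → coeff F (p + q) k K.≈ coeff F p k K.+ coeff F q k
    coeff-+ []      q       k       = K.sym (K.+-identityˡ _)
    coeff-+ (a ∷ p) []      k       = K.sym (K.+-identityʳ _)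
    coeff-+ (a ∷ p) (b ∷ q) zero    = K.refl
    coeff-+ (a ∷ p) (b ∷ q) (suc k) = coeff-+ p q k

    coeff-map : ∀ f → f K.0# K.≈ K.0# → ∀ p k → coeff F (map f p) k K.≈ f (coeff F p k)
    coeff-map f f0≈0 []      k       = K.sym f0≈0
    coeff-map f f0≈0 (a ∷ p) zero    = K.refl
    coeff-map f f0≈0 (a ∷ p) (suc k) = coeff-map f f0≈0 p k

    coeff-scaleₚ : ∀ a p k → coeff F (scaleₚ F a p) k K.≈ a K.* coeff F p k
    coeff-scaleₚ a = coeff-map (a K.*_) (K.zeroʳ a)

    coeff-negₚ : ∀ p k → coeff F (negₚ F p) k K.≈ K.- coeff F p k
    coeff-negₚ = coeff-map K.-_ KP.-0#≈0#

    +-pointwise : ∀ p q r s →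
                  (∀ k → coeff F p k K.+ coeff F q k K.≈ coeff F r k K.+ coeff F s k) → p + q ≋ r + s
    +-pointwise p q r s h = mk≋ λ k →
      K.trans (coeff-+ p q k) (K.trans (h k) (K.sym (coeff-+ r s k)))

    +-cong : ∀ {p p′ q q′} → p ≋ p′ → q ≋ q′ → p + q ≋ p′ + q′
    +-cong {p} {p′} {q} {q′} p≋p′ q≋q′ =
      +-pointwise p q p′ q′ λ k → K.+-cong (≋⇒≈ₚ p≋p′ k) (≋⇒≈ₚ q≋q′ k)

    +-comm : ∀ p q → p + q ≋ q + p
    +-comm p q = +-pointwise p q q p λ _ → K.+-comm _ _

    +-assoc : ∀ p q r → (p + q) + r ≋ p + (q + r)
    +-assoc p q r = mk≋ λ k →
      K.trans (coeff-+ (p + q) r k) (K.trans (K.+-congʳ (coeff-+ p q k))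
        (K.trans (K.+-assoc _ _ _)
          (K.trans (K.+-congˡ (K.sym (coeff-+ q r k))) (K.sym (coeff-+ p (q + r) k)))))

    +-identityʳ : ∀ p → p + [] ≋ p
    +-identityʳ p = mk≋ λ k → K.trans (coeff-+ p [] k) (K.+-identityʳ _)

    -‿cong : ∀ {p q} → p ≋ q → negₚ F p ≋ negₚ F q
    -‿cong {p} {q} p≋q = mk≋ λ k →
      K.trans (coeff-negₚ p k) (K.trans (K.-‿cong (≋⇒≈ₚ p≋q k)) (K.sym (coeff-negₚ q k)))

    -‿inverseˡ : ∀ p → negₚ F p + p ≋ []
    -‿inverseˡ p = mk≋ λ k →
      K.trans (coeff-+ (negₚ F p) p k) (K.trans (K.+-congʳ (coeff-negₚ p k)) (K.-‿inverseˡ _))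

    +-isAbelianGroup : IsAbelianGroup _≋_ _+_ [] (negₚ F)
    +-isAbelianGroup = record
      { isGroup = record
        { isMonoid = record
          { isSemigroup = record
            { isMagma = record { isEquivalence = ≋-isEquivalence ; ∙-cong = +-cong }
            ; assoc   = +-assoc
            }
          ; identity = (λ _ → ≋-refl) , +-identityʳ
          }
        ; inverse = -‿inverseˡ , λ p → ≋-trans (+-comm p (negₚ F p)) (-‿inverseˡ p)
        ; ⁻¹-cong = -‿cong
        }
      ; comm = +-comm
      }

    +-abelianGroup : AbelianGroup c ℓ
    +-abelianGroup = record { isAbelianGroup = +-isAbelianGroup }

    open CommutativeSemigroupProperties (AbelianGroup.commutativeSemigroup +-abelianGroup)
      using (interchange; x∙yz≈y∙xz)

    scaleₚ-cong : ∀ {a b p q} → a K.≈ b → p ≋ q → scaleₚ F a p ≋ scaleₚ F b q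
    scaleₚ-cong {a} {b} {p} {q} a≈b p≋q = mk≋ λ k →
      K.trans (coeff-scaleₚ a p k)
        (K.trans (K.*-cong a≈b (≋⇒≈ₚ p≋q k)) (K.sym (coeff-scaleₚ b q k)))

    scaleₚ-distribˡ : ∀ a p q → scaleₚ F a (p + q) ≋ scaleₚ F a p + scaleₚ F a q
    scaleₚ-distribˡ a p q = mk≋ λ k →
      K.trans (coeff-scaleₚ a (p + q) k) (K.trans (K.*-congˡ (coeff-+ p q k))
        (K.trans (K.distribˡ _ _ _)
          (K.trans (K.+-cong (K.sym (coeff-scaleₚ a p k)) (K.sym (coeff-scaleₚ a q k)))
            (K.sym (coeff-+ (scaleₚ F a p) (scaleₚ F a q) k)))))

    scaleₚ-distribʳ : ∀ a b p → scaleₚ F (a K.+ b) p ≋ scaleₚ F a p + scaleₚ F b p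
    scaleₚ-distribʳ a b p = mk≋ λ k →
      K.trans (coeff-scaleₚ (a K.+ b) p k) (K.trans (K.distribʳ _ _ _)
        (K.trans (K.+-cong (K.sym (coeff-scaleₚ a p k)) (K.sym (coeff-scaleₚ b p k)))
          (K.sym (coeff-+ (scaleₚ F a p) (scaleₚ F b p) k))))

    scaleₚ-assoc : ∀ a b p → scaleₚ F a (scaleₚ F b p) ≋ scaleₚ F (a K.* b) p
    scaleₚ-assoc a b p = mk≋ λ k →
      K.trans (coeff-scaleₚ a (scaleₚ F b p) k) (K.trans (K.*-congˡ (coeff-scaleₚ b p k))
        (K.trans (K.sym (K.*-assoc _ _ _)) (K.sym (coeff-scaleₚ (a K.* b) p k))))

    scaleₚ-≈0 : ∀ {a} p → a K.≈ K.0# → scaleₚ F a p ≋ []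
    scaleₚ-≈0 {a} p a≈0 = mk≋ λ k →
      K.trans (coeff-scaleₚ a p k) (K.trans (K.*-congʳ a≈0) (K.zeroˡ _))

    0∷-+ : ∀ p q → K.0# ∷ (p + q) ≋ (K.0# ∷ p) + (K.0# ∷ q)
    0∷-+ p q = ∷-cong (K.sym (K.+-identityˡ K.0#)) ≋-refl

  scaleₚ-1 : ∀ p → scaleₚ F K.1# p ≋ p
  scaleₚ-1 p = mk≋ λ k → K.trans (coeff-scaleₚ K.1# p k) (K.*-identityˡ _)

  private
    0∷-≋[] : ∀ {r} → r ≋ [] → K.0# ∷ r ≋ []
    0∷-≋[] r≋[] = mk≋ λ { zero → K.refl ; (suc k) → ≋⇒≈ₚ r≋[] k }

    tail-≋[] : ∀ {a p} → a ∷ p ≋ [] → p ≋ []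
    tail-≋[] a∷p≋[] = mk≋ λ k → ≋⇒≈ₚ a∷p≋[] (suc k)

    *-zero-≋ : ∀ p q → p ≋ [] → p * q ≋ []
    *-zero-≋ []      q _      = ≋-refl
    *-zero-≋ (b ∷ p) q b∷p≋[] =
      +-cong (scaleₚ-≈0 q (≋⇒≈ₚ b∷p≋[] zero)) (0∷-≋[] (*-zero-≋ p q (tail-≋[] b∷p≋[])))

    *-congʳ : ∀ p p′ q → p ≋ p′ → p * q ≋ p′ * q
    *-congʳ []      p′       q p≋p′ = ≋-sym (*-zero-≋ p′ q (≋-sym p≋p′))
    *-congʳ (a ∷ p) []       q p≋p′ = *-zero-≋ (a ∷ p) q p≋p′
    *-congʳ (a ∷ p) (b ∷ p′) q p≋p′ =
      +-cong (scaleₚ-cong (≋⇒≈ₚ p≋p′ zero) ≋-refl)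
             (∷-cong K.refl (*-congʳ p p′ q (mk≋ λ k → ≋⇒≈ₚ p≋p′ (suc k))))

    *-congˡ : ∀ p {q q′} → q ≋ q′ → p * q ≋ p * q′
    *-congˡ []      q≋q′ = ≋-refl
    *-congˡ (a ∷ p) q≋q′ =
      +-cong (scaleₚ-cong K.refl q≋q′) (∷-cong K.refl (*-congˡ p q≋q′))

    *-cong : ∀ {p p′ q q′} → p ≋ p′ → q ≋ q′ → p * q ≋ p′ * q′
    *-cong {p} {p′} {q} p≋p′ q≋q′ = ≋-trans (*-congʳ p p′ q p≋p′) (*-congˡ p′ q≋q′)

    0∷-* : ∀ p q → (K.0# ∷ p) * q ≋ K.0# ∷ (p * q)
    0∷-* p q = +-cong (scaleₚ-≈0 q K.refl) ≋-refl

    *-distribʳ : ∀ p q r → (p + q) * r ≋ p * r + q * r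
    *-distribʳ []      q       r = ≋-refl
    *-distribʳ (a ∷ p) []      r = ≋-sym (+-identityʳ _)
    *-distribʳ (a ∷ p) (b ∷ q) r = ≋-trans
      (+-cong (scaleₚ-distribʳ a b r)
              (≋-trans (∷-cong K.refl (*-distribʳ p q r)) (0∷-+ (p * r) (q * r))))
      (interchange (scaleₚ F a r) (scaleₚ F b r) _ _)

    *-zeroʳ : ∀ p → p * [] ≋ []
    *-zeroʳ []      = ≋-refl
    *-zeroʳ (a ∷ p) = 0∷-≋[] (*-zeroʳ p)

    *-∷ : ∀ p b q → p * (b ∷ q) ≋ scaleₚ F b p + (K.0# ∷ p * q)
    *-∷ []      b q = ≋-sym (0∷-≋[] ≋-refl)
    *-∷ (a ∷ p) b q = ∷-cong (K.+-congʳ (K.*-comm a b))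
      (≋-trans (+-cong ≋-refl (*-∷ p b q)) (x∙yz≈y∙xz (scaleₚ F a q) (scaleₚ F b p) _))

    *-comm : ∀ p q → p * q ≋ q * p
    *-comm []      q = ≋-sym (*-zeroʳ q)
    *-comm (a ∷ p) q =
      ≋-trans (+-cong ≋-refl (∷-cong K.refl (*-comm p q))) (≋-sym (*-∷ q a p))

    scaleₚ-* : ∀ a p q → scaleₚ F a p * q ≋ scaleₚ F a (p * q)
    scaleₚ-* a []      q = ≋-refl
    scaleₚ-* a (b ∷ p) q = ≋-trans
      (+-cong (≋-sym (scaleₚ-assoc a b q)) (∷-cong (K.sym (K.zeroʳ a)) (scaleₚ-* a p q)))
      (≋-sym (scaleₚ-distribˡ a (scaleₚ F b q) (K.0# ∷ p * q)))

    *-assoc : ∀ p q r → (p * q) * r ≋ p * (q * r)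
    *-assoc []      q r = ≋-refl
    *-assoc (a ∷ p) q r = ≋-trans (*-distribʳ (scaleₚ F a q) (K.0# ∷ p * q) r)
      (+-cong (scaleₚ-* a q r) (≋-trans (0∷-* (p * q) r) (∷-cong K.refl (*-assoc p q r))))

    *-identityˡ : ∀ p → 1ₚ F * p ≋ p
    *-identityˡ p = ≋-trans (+-cong (scaleₚ-1 p) (0∷-≋[] ≋-refl)) (+-identityʳ p)

  polyRing : CommutativeRing c ℓ
  polyRing = record
    { Carrier           = Poly F
    ; _≈_               = _≋_
    ; _+_               = _+_
    ; _*_               = _*_
    ; -_                = negₚ F
    ; 0#                = 0ₚ F
    ; 1#                = 1ₚ F
    ; isCommutativeRing = record
      { isRing = record
        { +-isAbelianGroup = +-isAbelianGroup
        ; *-cong           = *-cong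
        ; *-assoc          = *-assoc
        ; *-identity       = *-identityˡ , λ p → ≋-trans (*-comm p (1ₚ F)) (*-identityˡ p)
        ; distrib          = (λ p q r → ≋-trans (*-comm p (q + r))
                                          (≋-trans (*-distribʳ q r p) (+-cong (*-comm q p) (*-comm r p))))
                           , (λ r p q → *-distribʳ p q r)
        }
      ; *-comm = *-comm
      }
    }

  constₚ-cong : ∀ {x y} → x K.≈ y → constₚ F x ≋ constₚ F y
  constₚ-cong x≈y = ∷-cong x≈y ≋-refl

  constₚ-≈0 : ∀ {x} → x K.≈ K.0# → constₚ F x ≋ []
  constₚ-≈0 x≈0 = mk≋ λ { zero → x≈0 ; (suc k) → K.refl }

  constₚ-* : ∀ x y → constₚ F (x K.* y) ≋ constₚ F x * constₚ F y
  constₚ-* x y = ∷-cong (K.sym (K.+-identityʳ _)) ≋-refl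

  scaleₚ≈constₚ-* : ∀ a p → scaleₚ F a p ≋ constₚ F a * p
  scaleₚ≈constₚ-* a p = ≋-sym (≋-trans (+-cong ≋-refl (0∷-≋[] ≋-refl)) (+-identityʳ _))

module Matrices {c ℓ} (F : CommutativeRing c ℓ) where
  open Polynomials F
  open CommutativeRing polyRing hiding (zero)
  open RingProperties ring using (-0#≈0#; -‿involutive; -‿distribˡ-*)
  open CommutativeSemigroupProperties +-commutativeSemigroup
    using () renaming (interchange to +-interchange)
  open CommutativeSemigroupProperties *-commutativeSemigroup
    using () renaming (x∙yz≈y∙xz to x*yz≈y*xz)
  open SetoidReasoning setoid
  private module K = CommutativeRing F

  x≈0⇒x*y≈0 : ∀ {x} y → x ≈ 0# → x * y ≈ 0#
  x≈0⇒x*y≈0 y x≈0 = trans (*-congʳ {y} x≈0) (zeroˡ y)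

  y≈0⇒x*y≈0 : ∀ x {y} → y ≈ 0# → x * y ≈ 0#
  y≈0⇒x*y≈0 x y≈0 = trans (*-congˡ {x} y≈0) (zeroʳ x)

  sumₚ-cong : ∀ {n} {f g : Fin n → Poly F} → (∀ i → f i ≈ g i) → sumₚ F f ≈ sumₚ F g
  sumₚ-cong {zero}  _   = refl
  sumₚ-cong {suc n} f≈g = +-cong (f≈g zero) (sumₚ-cong (f≈g ∘ suc))

  sumₚ-zero : ∀ {n} {f : Fin n → Poly F} → (∀ i → f i ≈ 0#) → sumₚ F f ≈ 0#
  sumₚ-zero {zero}  _   = refl
  sumₚ-zero {suc n} f≈0 = trans (+-cong (f≈0 zero) (sumₚ-zero (f≈0 ∘ suc))) (+-identityˡ 0#)

  sumₚ-split : ∀ k {l} (f : Fin (k +ℕ l) → Poly F) →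
               sumₚ F f ≈ sumₚ F (λ i → f (i ↑ˡ l)) + sumₚ F (λ j → f (k ↑ʳ j))
  sumₚ-split zero    f = refl
  sumₚ-split (suc k) f =
    trans (+-congˡ {f zero} (sumₚ-split k (f ∘ suc))) (sym (+-assoc (f zero) _ _))

  sumₚ-+ : ∀ {n} (f g : Fin n → Poly F) → sumₚ F (λ i → f i + g i) ≈ sumₚ F f + sumₚ F g
  sumₚ-+ {zero}  f g = refl
  sumₚ-+ {suc n} f g = trans (+-congˡ {f zero + g zero} (sumₚ-+ (f ∘ suc) (g ∘ suc)))
                             (+-interchange (f zero) (g zero) _ _)

  *-distribˡ-sumₚ : ∀ {n} p (f : Fin n → Poly F) → p * sumₚ F f ≈ sumₚ F (λ i → p * f i)
  *-distribˡ-sumₚ {zero}  p f = zeroʳ p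
  *-distribˡ-sumₚ {suc n} p f =
    trans (distribˡ p (f zero) _) (+-congˡ {p * f zero} (*-distribˡ-sumₚ p (f ∘ suc)))

  *-distribʳ-sumₚ : ∀ {n} p (f : Fin n → Poly F) → sumₚ F f * p ≈ sumₚ F (λ i → f i * p)
  *-distribʳ-sumₚ {zero}  p f = zeroˡ p
  *-distribʳ-sumₚ {suc n} p f =
    trans (distribʳ p (f zero) _) (+-congˡ {f zero * p} (*-distribʳ-sumₚ p (f ∘ suc)))

  signₚ-cong : ∀ k {p q} → p ≈ q → signₚ F k p ≈ signₚ F k q
  signₚ-cong zero    p≈q = p≈q
  signₚ-cong (suc k) p≈q = -‿cong (signₚ-cong k p≈q)

  signₚ-≈0 : ∀ k {p} → p ≈ 0# → signₚ F k p ≈ 0#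
  signₚ-≈0 zero    p≈0 = p≈0
  signₚ-≈0 (suc k) p≈0 = trans (-‿cong (signₚ-≈0 k p≈0)) -0#≈0#

  signₚ-*ˡ : ∀ k p q → signₚ F k (p * q) ≈ signₚ F k p * q
  signₚ-*ˡ zero    p q = refl
  signₚ-*ˡ (suc k) p q = trans (-‿cong (signₚ-*ˡ k p q)) (-‿distribˡ-* (signₚ F k p) q)

  signₚ-*ʳ : ∀ k p q → signₚ F k (p * q) ≈ p * signₚ F k q
  signₚ-*ʳ k p q = begin
    signₚ F k (p * q) ≈⟨ signₚ-cong k (*-comm p q) ⟩
    signₚ F k (q * p) ≈⟨ signₚ-*ˡ k q p ⟩
    signₚ F k q * p   ≈⟨ *-comm _ p ⟩
    p * signₚ F k q   ∎

  signₚ-shift : ∀ d x y p → signₚ F (d +ℕ x +ℕ (d +ℕ y)) p ≈ signₚ F (x +ℕ y) p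
  signₚ-shift zero    x y p = refl
  signₚ-shift (suc d) x y p = begin
    signₚ F (suc (d +ℕ x +ℕ suc (d +ℕ y))) p
      ≡⟨ ≡.cong (λ e → signₚ F (suc e) p) (+-suc (d +ℕ x) (d +ℕ y)) ⟩
    signₚ F (suc (suc (d +ℕ x +ℕ (d +ℕ y)))) p
      ≈⟨ -‿involutive _ ⟩
    signₚ F (d +ℕ x +ℕ (d +ℕ y)) p
      ≈⟨ signₚ-shift d x y p ⟩
    signₚ F (x +ℕ y) p
      ∎

  -- Determinants of block matrices

  det-cong : ∀ {n} {M N : MatP F n} → (∀ i j → M i j ≈ N i j) → detP F M ≈ detP F N
  det-cong {zero}          _   = refl
  det-cong {suc n} {M} {N} M≈N = sumₚ-cong λ j → signₚ-cong (toℕ j)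
    (*-cong (M≈N zero j) (det-cong {M = minor F zero j M} {minor F zero j N} λ _ _ → M≈N _ _))

  -- The zero block confines the first k + 1 rows (resp. columns) of M to k coordinates.
  det-wideZeroBlock : ∀ {N} (M : MatP F N) k → k < N →
                      (∀ r s → toℕ r ≤ k → k ≤ toℕ s → M r s ≈ 0#) → detP F M ≈ 0#
  det-wideZeroBlock {suc N} M zero _ block≈0 = sumₚ-zero λ j → signₚ-≈0 (toℕ j)
    (x≈0⇒x*y≈0 (detP F (minor F zero j M)) (block≈0 zero j z≤n z≤n))
  det-wideZeroBlock {suc N} M (suc k) (s≤s k<N) block≈0 = sumₚ-zero λ j → signₚ-≈0 (toℕ j) (term j)
    where
      term : ∀ j → M zero j * detP F (minor F zero j M) ≈ 0#
      term j with toℕ j ≤? k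
      ... | yes j≤k = y≈0⇒x*y≈0 (M zero j) (det-wideZeroBlock (minor F zero j M) k k<N
              λ r s r≤k k≤s → block≈0 (suc r) (punchIn j s) (s≤s r≤k)
                (≤-trans (s≤s k≤s) (≤-reflexive (≡.sym (toℕ-punchIn-≥ j s (≤-trans j≤k k≤s))))))
      ... | no j≰k  = x≈0⇒x*y≈0 (detP F (minor F zero j M)) (block≈0 zero j z≤n (≰⇒> j≰k))

  det-tallZeroBlock : ∀ {N} (M : MatP F N) k → k < N →
                      (∀ r s → k ≤ toℕ r → toℕ s ≤ k → M r s ≈ 0#) → detP F M ≈ 0#
  det-tallZeroBlock {suc N} M zero _ block≈0 = sumₚ-zero λ j → signₚ-≈0 (toℕ j) (term j)
    where
      term : ∀ j → M zero j * detP F (minor F zero j M) ≈ 0#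
      term zero    = x≈0⇒x*y≈0 (detP F (minor F zero zero M)) (block≈0 zero zero z≤n z≤n)
      term (suc j) = y≈0⇒x*y≈0 (M zero (suc j))
        (det-tallZeroBlock (minor F zero (suc j) M) zero (<-≤-trans (s≤s z≤n) (toℕ<n j))
          λ { r zero _ _ → block≈0 (suc r) zero z≤n z≤n })
  det-tallZeroBlock {suc N} M (suc k) (s≤s k<N) block≈0 = sumₚ-zero λ j → signₚ-≈0 (toℕ j)
    (y≈0⇒x*y≈0 (M zero j) (det-tallZeroBlock (minor F zero j M) k k<N
      λ r s k≤r s≤k → block≈0 (suc r) (punchIn j s) (s≤s k≤r) (≤-trans (toℕ-punchIn-≤ j s) (s≤s s≤k))))

  -- Blocks are located through toℕ because a minor of a matrix of size k + l has size k + l − 1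
  -- only up to propositional equality.
  record BlockLowerTriangular {N} k l (M : MatP F N) (P : MatP F k) (Q : MatP F l) : Set ℓ where
    field
      size         : k +ℕ l ≡ N
      upper        : ∀ r s a b → toℕ r ≡ toℕ a → toℕ s ≡ toℕ b → M r s ≈ P a b
      lower        : ∀ r s a b → toℕ r ≡ k +ℕ toℕ a → toℕ s ≡ k +ℕ toℕ b → M r s ≈ Q a b
      upperRight≈0 : ∀ r s → toℕ r < k → k ≤ toℕ s → M r s ≈ 0#

  minor-upperBlock : ∀ {k l N} {M : MatP F (suc N)} {P Q} → BlockLowerTriangular (suc k) l M P Q →
                     ∀ r s i j → toℕ r ≡ toℕ i → toℕ s ≡ toℕ j →
                     BlockLowerTriangular k l (minor F r s M) (minor F i j P) Q
  minor-upperBlock {k} blt r s i j r≡i s≡j = record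
    { size         = suc-injective size
    ; upper        = λ r′ s′ a b r′≡a s′≡b → upper _ _ _ _
        (toℕ-punchIn-shift 0 r r′ i a r≡i r′≡a) (toℕ-punchIn-shift 0 s s′ j b s≡j s′≡b)
    ; lower        = λ r′ s′ a b r′≡ s′≡ → lower _ _ a b (past r r≡i r′ r′≡) (past s s≡j s′ s′≡)
    ; upperRight≈0 = λ r′ s′ r′<k k≤s′ → upperRight≈0 _ _
        (s≤s (≤-trans (toℕ-punchIn-≤ r r′) r′<k))
        (≤-trans (s≤s k≤s′) (≤-reflexive (≡.sym (toℕ-punchIn-≥ s s′ (≤-trans (atMost s s≡j) k≤s′)))))
    }
    where
      open BlockLowerTriangular blt
      atMost : ∀ {N} (x : Fin (suc N)) {y : Fin (suc k)} → toℕ x ≡ toℕ y → toℕ x ≤ k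
      atMost x {y} x≡y = ≡.subst (_≤ k) (≡.sym x≡y) (toℕ≤pred[n] y)
      past : ∀ {N} (x : Fin (suc N)) {y : Fin (suc k)} → toℕ x ≡ toℕ y →
             ∀ (x′ : Fin N) {a} → toℕ x′ ≡ k +ℕ a → toℕ (punchIn x x′) ≡ suc k +ℕ a
      past x x≡y x′ x′≡ = ≡.trans
        (toℕ-punchIn-≥ x x′ (≤-trans (atMost x x≡y) (≡.subst (k ≤_) (≡.sym x′≡) (m≤m+n k _))))
        (≡.cong suc x′≡)

  minor-lowerBlock : ∀ {k l N} {M : MatP F (suc N)} {P Q} → BlockLowerTriangular k (suc l) M P Q →
                     ∀ r s i j → toℕ r ≡ k +ℕ toℕ i → toℕ s ≡ k +ℕ toℕ j →
                     BlockLowerTriangular k l (minor F r s M) P (minor F i j Q)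
  minor-lowerBlock {k} {l} blt r s i j r≡ s≡ = record
    { size         = suc-injective (≡.trans (≡.sym (+-suc k l)) size)
    ; upper        = λ r′ s′ a b r′≡a s′≡b → upper _ _ a b (before r r≡ r′ r′≡a) (before s s≡ s′ s′≡b)
    ; lower        = λ r′ s′ a b r′≡ s′≡ → lower _ _ _ _
        (toℕ-punchIn-shift k r r′ i a r≡ r′≡) (toℕ-punchIn-shift k s s′ j b s≡ s′≡)
    ; upperRight≈0 = λ r′ s′ r′<k k≤s′ → upperRight≈0 _ _
        (≡.subst (_< k) (≡.sym (toℕ-punchIn-< r r′ (<-≤-trans r′<k (atLeast r r≡)))) r′<k)
        (≤-trans k≤s′ (toℕ≤toℕ-punchIn s s′))
    }
    where
      open BlockLowerTriangular blt
      atLeast : ∀ {N} (x : Fin (suc N)) {a} → toℕ x ≡ k +ℕ a → k ≤ toℕ x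
      atLeast x x≡ = ≡.subst (k ≤_) (≡.sym x≡) (m≤m+n k _)
      before : ∀ {N} (x : Fin (suc N)) {a} → toℕ x ≡ k +ℕ a →
               ∀ (x′ : Fin N) {b : Fin k} → toℕ x′ ≡ toℕ b → toℕ (punchIn x x′) ≡ toℕ b
      before x x≡ x′ {b} x′≡b = ≡.trans
        (toℕ-punchIn-< x x′ (<-≤-trans (≡.subst (_< k) (≡.sym x′≡b) (toℕ<n b)) (atLeast x x≡))) x′≡b

  det-blockLowerTriangular : ∀ {k l N} {M : MatP F N} {P Q} → BlockLowerTriangular k l M P Q →
                             detP F M ≈ detP F P * detP F Q
  det-blockLowerTriangular {zero} {M = M} {P} {Q} blt@record { size = ≡.refl } = begin
    detP F M        ≈⟨ det-cong (λ r s → lower r s r s ≡.refl ≡.refl) ⟩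
    detP F Q        ≈⟨ *-identityˡ (detP F Q) ⟨
    1# * detP F Q   ∎
    where open BlockLowerTriangular blt
  det-blockLowerTriangular {suc k} {l} {M = M} {P} {Q} blt@record { size = ≡.refl } = begin
    detP F M
      ≈⟨ sumₚ-split (suc k) term ⟩
    sumₚ F (λ c → term (c ↑ˡ l)) + sumₚ F (λ d → term (suc k ↑ʳ d))
      ≈⟨ +-cong (sumₚ-cong upperColumn) (sumₚ-zero upperRightColumn) ⟩
    sumₚ F (λ c → termP c * detP F Q) + 0#
      ≈⟨ +-identityʳ _ ⟩
    sumₚ F (λ c → termP c * detP F Q)
      ≈⟨ *-distribʳ-sumₚ (detP F Q) termP ⟨
    detP F P * detP F Q
      ∎
    where
      open BlockLowerTriangular blt
      term : Fin (suc k +ℕ l) → Poly F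
      term j = signₚ F (toℕ j) (M zero j * detP F (minor F zero j M))
      termP : Fin (suc k) → Poly F
      termP c = signₚ F (toℕ c) (P zero c * detP F (minor F zero c P))
      upperColumn : ∀ c → term (c ↑ˡ l) ≈ termP c * detP F Q
      upperColumn c = begin
        term (c ↑ˡ l)
          ≡⟨ ≡.cong (λ e → signₚ F e (M zero (c ↑ˡ l) * detP F (minor F zero (c ↑ˡ l) M))) (toℕ-↑ˡ c l) ⟩
        signₚ F (toℕ c) (M zero (c ↑ˡ l) * detP F (minor F zero (c ↑ˡ l) M))
          ≈⟨ signₚ-cong (toℕ c) (*-cong (upper _ _ _ _ ≡.refl (toℕ-↑ˡ c l)) (det-blockLowerTriangular
               (minor-upperBlock blt zero (c ↑ˡ l) zero c ≡.refl (toℕ-↑ˡ c l)))) ⟩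
        signₚ F (toℕ c) (P zero c * (detP F (minor F zero c P) * detP F Q))
          ≈⟨ signₚ-cong (toℕ c) (*-assoc (P zero c) _ _) ⟨
        signₚ F (toℕ c) (P zero c * detP F (minor F zero c P) * detP F Q)
          ≈⟨ signₚ-*ˡ (toℕ c) _ _ ⟩
        termP c * detP F Q
          ∎
      upperRightColumn : ∀ d → term (suc k ↑ʳ d) ≈ 0#
      upperRightColumn d = signₚ-≈0 (toℕ (suc k ↑ʳ d))
        (x≈0⇒x*y≈0 (detP F (minor F zero (suc k ↑ʳ d) M))
          (upperRight≈0 zero (suc k ↑ʳ d) (s≤s z≤n) (≤-toℕ-↑ʳ (suc k) d)))

  -- The adjugate of xI − (A ⊕ B)

  ⊕-upper : ∀ {n m} (A : Mat F n) (B : Mat F m) a b → _⊕_ F A B (a ↑ˡ m) (b ↑ˡ m) ≡ A a b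
  ⊕-upper {n} {m} A B a b rewrite splitAt-↑ˡ n a m | splitAt-↑ˡ n b m = ≡.refl

  ⊕-lower : ∀ {n m} (A : Mat F n) (B : Mat F m) a b → _⊕_ F A B (n ↑ʳ a) (n ↑ʳ b) ≡ B a b
  ⊕-lower {n} {m} A B a b rewrite splitAt-↑ʳ n m a | splitAt-↑ʳ n m b = ≡.refl

  ⊕-upperRight : ∀ {n m} (A : Mat F n) (B : Mat F m) {r s} →
                 toℕ r < n → n ≤ toℕ s → _⊕_ F A B r s ≡ K.0#
  ⊕-upperRight {n} {m} A B {r} {s} r<n n≤s with splitAt n r in r≡ | splitAt n s in s≡
  ... | inj₁ _ | inj₂ _ = ≡.refl
  ... | inj₂ b | _      = ⊥-elim (<⇒≱ r<n (≡.subst (λ x → n ≤ toℕ x) (splitAt⁻¹-↑ʳ r≡) (≤-toℕ-↑ʳ n b)))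
  ... | inj₁ _ | inj₁ a = ⊥-elim (<⇒≱ (≡.subst (λ x → toℕ x < n) (splitAt⁻¹-↑ˡ s≡) (toℕ-↑ˡ-< a m)) n≤s)

  ⊕-lowerLeft : ∀ {n m} (A : Mat F n) (B : Mat F m) {r s} →
                n ≤ toℕ r → toℕ s < n → _⊕_ F A B r s ≡ K.0#
  ⊕-lowerLeft {n} {m} A B {r} {s} n≤r s<n with splitAt n r in r≡ | splitAt n s in s≡
  ... | inj₂ _ | inj₁ _ = ≡.refl
  ... | inj₁ a | _      = ⊥-elim (<⇒≱ (≡.subst (λ x → toℕ x < n) (splitAt⁻¹-↑ˡ r≡) (toℕ-↑ˡ-< a m)) n≤r)
  ... | inj₂ _ | inj₂ b = ⊥-elim (<⇒≱ s<n (≡.subst (λ x → n ≤ toℕ x) (splitAt⁻¹-↑ʳ s≡) (≤-toℕ-↑ʳ n b)))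

  xI-C-reindex : ∀ {k N} (C : Mat F N) (D : Mat F k) (e : Fin k → Fin N) →
                 (∀ {a b} → e a ≡ e b → a ≡ b) →
                 ∀ a b → C (e a) (e b) K.≈ D a b → xI-C F C (e a) (e b) ≈ xI-C F D a b
  xI-C-reindex C D e e-injective a b C≈D with e a Fin.≟ e b | a Fin.≟ b
  ... | yes _     | yes _   = ∷-cong (K.-‿cong C≈D) refl
  ... | no _      | no _    = ∷-cong (K.-‿cong C≈D) refl
  ... | yes ea≡eb | no a≢b  = ⊥-elim (a≢b (e-injective ea≡eb))
  ... | no ea≢eb  | yes a≡b = ⊥-elim (ea≢eb (≡.cong e a≡b))

  xI-C-offDiagonal : ∀ {N} (C : Mat F N) {i j} → i ≢ j → C i j K.≈ K.0# → xI-C F C i j ≈ 0#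
  xI-C-offDiagonal C {i} {j} i≢j Cij≈0 with i Fin.≟ j
  ... | yes i≡j = ⊥-elim (i≢j i≡j)
  ... | no _    = trans (-‿cong (constₚ-≈0 Cij≈0)) -0#≈0#

  xI-C-⊕-blockLowerTriangular : ∀ {n m} (A : Mat F n) (B : Mat F m) →
    BlockLowerTriangular n m (xI-C F (_⊕_ F A B)) (xI-C F A) (xI-C F B)
  xI-C-⊕-blockLowerTriangular {n} {m} A B = record
    { size         = ≡.refl
    ; upper        = λ r s a b r≡a s≡b → ≡.subst₂ (λ r s → xI-C F (_⊕_ F A B) r s ≈ xI-C F A a b)
        (toℕ-injective (≡.trans (toℕ-↑ˡ a m) (≡.sym r≡a)))
        (toℕ-injective (≡.trans (toℕ-↑ˡ b m) (≡.sym s≡b)))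
        (xI-C-reindex (_⊕_ F A B) A (_↑ˡ m) (↑ˡ-injective m _ _) a b (K.reflexive (⊕-upper A B a b)))
    ; lower        = λ r s a b r≡a s≡b → ≡.subst₂ (λ r s → xI-C F (_⊕_ F A B) r s ≈ xI-C F B a b)
        (toℕ-injective (≡.trans (toℕ-↑ʳ n a) (≡.sym r≡a)))
        (toℕ-injective (≡.trans (toℕ-↑ʳ n b) (≡.sym s≡b)))
        (xI-C-reindex (_⊕_ F A B) B (n ↑ʳ_) (↑ʳ-injective n _ _) a b (K.reflexive (⊕-lower A B a b)))
    ; upperRight≈0 = λ r s r<n n≤s → xI-C-offDiagonal (_⊕_ F A B)
        (λ r≡s → <⇒≱ r<n (≡.subst (λ x → n ≤ toℕ x) (≡.sym r≡s) n≤s))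
        (K.reflexive (⊕-upperRight A B r<n n≤s))
    }

  xI-C-⊕-lowerLeft : ∀ {n m} (A : Mat F n) (B : Mat F m) r s → n ≤ toℕ r → toℕ s < n →
                     xI-C F (_⊕_ F A B) r s ≈ 0#
  xI-C-⊕-lowerLeft {n} A B r s n≤r s<n = xI-C-offDiagonal (_⊕_ F A B)
    (λ r≡s → <⇒≱ s<n (≡.subst (λ x → n ≤ toℕ x) r≡s n≤r)) (K.reflexive (⊕-lowerLeft A B n≤r s<n))

  adj-⊕-upper : ∀ {n m} (A : Mat F n) (B : Mat F m) a b →
                adjP F (xI-C F (_⊕_ F A B)) (a ↑ˡ m) (b ↑ˡ m) ≈ charP F B * adjP F (xI-C F A) a b
  adj-⊕-upper {suc n} {m} A B a b = begin
    signₚ F (toℕ (a ↑ˡ m) +ℕ toℕ (b ↑ˡ m)) (detP F (minor F (b ↑ˡ m) (a ↑ˡ m) M))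
      ≡⟨ ≡.cong₂ (λ x y → signₚ F (x +ℕ y) (detP F (minor F (b ↑ˡ m) (a ↑ˡ m) M)))
                 (toℕ-↑ˡ a m) (toℕ-↑ˡ b m) ⟩
    signₚ F ab (detP F (minor F (b ↑ˡ m) (a ↑ˡ m) M))
      ≈⟨ signₚ-cong ab (det-blockLowerTriangular
           (minor-upperBlock (xI-C-⊕-blockLowerTriangular A B) _ _ b a (toℕ-↑ˡ b m) (toℕ-↑ˡ a m))) ⟩
    signₚ F ab (detP F (minor F b a (xI-C F A)) * charP F B)
      ≈⟨ signₚ-*ˡ ab _ _ ⟩
    adjP F (xI-C F A) a b * charP F B
      ≈⟨ *-comm (adjP F (xI-C F A) a b) (charP F B) ⟩
    charP F B * adjP F (xI-C F A) a b
      ∎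
    where
      M = xI-C F (_⊕_ F A B)
      ab = toℕ a +ℕ toℕ b

  adj-⊕-lower : ∀ {n m} (A : Mat F n) (B : Mat F m) a b →
                adjP F (xI-C F (_⊕_ F A B)) (n ↑ʳ a) (n ↑ʳ b) ≈ charP F A * adjP F (xI-C F B) a b
  adj-⊕-lower {zero}  {suc m} A B a b = sym (*-identityˡ _)
  adj-⊕-lower {suc n} {suc m} A B a b = begin
    signₚ F (toℕ (suc n ↑ʳ a) +ℕ toℕ (suc n ↑ʳ b)) (detP F (minor F (suc n ↑ʳ b) (suc n ↑ʳ a) M))
      ≡⟨ ≡.cong₂ (λ x y → signₚ F (x +ℕ y) (detP F (minor F (suc n ↑ʳ b) (suc n ↑ʳ a) M)))
                 (toℕ-↑ʳ (suc n) a) (toℕ-↑ʳ (suc n) b) ⟩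
    signₚ F (suc n +ℕ toℕ a +ℕ (suc n +ℕ toℕ b)) (detP F (minor F (suc n ↑ʳ b) (suc n ↑ʳ a) M))
      ≈⟨ signₚ-shift (suc n) (toℕ a) (toℕ b) _ ⟩
    signₚ F ab (detP F (minor F (suc n ↑ʳ b) (suc n ↑ʳ a) M))
      ≈⟨ signₚ-cong ab (det-blockLowerTriangular (minor-lowerBlock (xI-C-⊕-blockLowerTriangular A B)
           _ _ b a (toℕ-↑ʳ (suc n) b) (toℕ-↑ʳ (suc n) a))) ⟩
    signₚ F ab (charP F A * detP F (minor F b a (xI-C F B)))
      ≈⟨ signₚ-*ʳ ab (charP F A) _ ⟩
    charP F A * adjP F (xI-C F B) a b
      ∎
    where
      M = xI-C F (_⊕_ F A B)
      ab = toℕ a +ℕ toℕ b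

  adj-⊕-upperRight : ∀ {n m} (A : Mat F n) (B : Mat F m) a b →
                     adjP F (xI-C F (_⊕_ F A B)) (a ↑ˡ m) (n ↑ʳ b) ≈ 0#
  adj-⊕-upperRight {suc n} {suc m} A B a b = signₚ-≈0 (toℕ (a ↑ˡ suc m) +ℕ toℕ (suc n ↑ʳ b))
    (det-wideZeroBlock (minor F (suc n ↑ʳ b) (a ↑ˡ suc m) (xI-C F (_⊕_ F A B))) n (m<m+n n (s≤s z≤n))
      λ r s r≤n n≤s → upperRight≈0 _ _ (toℕ-punchIn-↑ʳ-< b r r≤n) (toℕ-punchIn-↑ˡ-≥ a s n≤s))
    where open BlockLowerTriangular (xI-C-⊕-blockLowerTriangular A B)

  adj-⊕-lowerLeft : ∀ {n m} (A : Mat F n) (B : Mat F m) a b →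
                    adjP F (xI-C F (_⊕_ F A B)) (n ↑ʳ a) (b ↑ˡ m) ≈ 0#
  adj-⊕-lowerLeft {suc n} {suc m} A B a b = signₚ-≈0 (toℕ (suc n ↑ʳ a) +ℕ toℕ (b ↑ˡ suc m))
    (det-tallZeroBlock (minor F (b ↑ˡ suc m) (suc n ↑ʳ a) (xI-C F (_⊕_ F A B))) n (m<m+n n (s≤s z≤n))
      λ r s n≤r s≤n → xI-C-⊕-lowerLeft A B _ _ (toℕ-punchIn-↑ˡ-≥ b r n≤r) (toℕ-punchIn-↑ʳ-< a s s≤n))

  -- ∂char of a block sum

  record IsBlockDiagonal {n m} (M : MatP F (n +ℕ m)) (P : MatP F n) (Q : MatP F m) : Set ℓ where
    field
      upper≈       : ∀ a b → M (a ↑ˡ m) (b ↑ˡ m) ≈ P a b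
      lower≈       : ∀ a b → M (n ↑ʳ a) (n ↑ʳ b) ≈ Q a b
      upperRight≈0 : ∀ a b → M (a ↑ˡ m) (n ↑ʳ b) ≈ 0#
      lowerLeft≈0  : ∀ a b → M (n ↑ʳ a) (b ↑ˡ m) ≈ 0#

  module _ {n m} {G : MatP F (n +ℕ m)} {P : MatP F n} {Q : MatP F m} (G-diag : IsBlockDiagonal G P Q)
    where
    open IsBlockDiagonal G-diag

    ·ₚ-upperRows : ∀ (X : MatP F (n +ℕ m)) a j →
                   _·ₚ_ F G X (a ↑ˡ m) j ≈ sumₚ F (λ k → P a k * X (k ↑ˡ m) j)
    ·ₚ-upperRows X a j = begin
      sumₚ F (λ k → G (a ↑ˡ m) k * X k j)
        ≈⟨ sumₚ-split n (λ k → G (a ↑ˡ m) k * X k j) ⟩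
      sumₚ F (λ k → G (a ↑ˡ m) (k ↑ˡ m) * X (k ↑ˡ m) j)
        + sumₚ F (λ k → G (a ↑ˡ m) (n ↑ʳ k) * X (n ↑ʳ k) j)
        ≈⟨ +-cong (sumₚ-cong λ k → *-congʳ (upper≈ a k))
                  (sumₚ-zero λ k → x≈0⇒x*y≈0 (X (n ↑ʳ k) j) (upperRight≈0 a k)) ⟩
      sumₚ F (λ k → P a k * X (k ↑ˡ m) j) + 0#
        ≈⟨ +-identityʳ _ ⟩
      sumₚ F (λ k → P a k * X (k ↑ˡ m) j)
        ∎

    ·ₚ-lowerRows : ∀ (X : MatP F (n +ℕ m)) a j →
                   _·ₚ_ F G X (n ↑ʳ a) j ≈ sumₚ F (λ k → Q a k * X (n ↑ʳ k) j)
    ·ₚ-lowerRows X a j = begin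
      sumₚ F (λ k → G (n ↑ʳ a) k * X k j)
        ≈⟨ sumₚ-split n (λ k → G (n ↑ʳ a) k * X k j) ⟩
      sumₚ F (λ k → G (n ↑ʳ a) (k ↑ˡ m) * X (k ↑ˡ m) j)
        + sumₚ F (λ k → G (n ↑ʳ a) (n ↑ʳ k) * X (n ↑ʳ k) j)
        ≈⟨ +-cong (sumₚ-zero λ k → x≈0⇒x*y≈0 (X (k ↑ˡ m) j) (lowerLeft≈0 a k))
                  (sumₚ-cong λ k → *-congʳ (lower≈ a k)) ⟩
      0# + sumₚ F (λ k → Q a k * X (n ↑ʳ k) j)
        ≈⟨ +-identityˡ _ ⟩
      sumₚ F (λ k → Q a k * X (n ↑ʳ k) j)
        ∎

    ·ₚ-blockDiagonal : ∀ {H P′ Q′} → IsBlockDiagonal H P′ Q′ →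
                       IsBlockDiagonal (_·ₚ_ F G H) (_·ₚ_ F P P′) (_·ₚ_ F Q Q′)
    ·ₚ-blockDiagonal {H} H-diag = record
      { upper≈       = λ a b → trans (·ₚ-upperRows H a (b ↑ˡ m))
          (sumₚ-cong λ k → *-congˡ {P a k} (H.upper≈ k b))
      ; lower≈       = λ a b → trans (·ₚ-lowerRows H a (n ↑ʳ b))
          (sumₚ-cong λ k → *-congˡ {Q a k} (H.lower≈ k b))
      ; upperRight≈0 = λ a b → trans (·ₚ-upperRows H a (n ↑ʳ b))
          (sumₚ-zero λ k → y≈0⇒x*y≈0 (P a k) (H.upperRight≈0 k b))
      ; lowerLeft≈0  = λ a b → trans (·ₚ-lowerRows H a (b ↑ˡ m))
          (sumₚ-zero λ k → y≈0⇒x*y≈0 (Q a k) (H.lowerLeft≈0 k b))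
      }
      where module H = IsBlockDiagonal H-diag

    traceP-·ₚ-blockDiagonal : ∀ (X : MatP F (n +ℕ m)) →
      traceP F (_·ₚ_ F G X) ≈ traceP F (_·ₚ_ F P (λ a b → X (a ↑ˡ m) (b ↑ˡ m)))
                            + traceP F (_·ₚ_ F Q (λ a b → X (n ↑ʳ a) (n ↑ʳ b)))
    traceP-·ₚ-blockDiagonal X = trans (sumₚ-split n (λ i → _·ₚ_ F G X i i))
      (+-cong (sumₚ-cong λ a → ·ₚ-upperRows X a (a ↑ˡ m)) (sumₚ-cong λ b → ·ₚ-lowerRows X b (n ↑ʳ b)))

  infixr 7 _*ₘ_
  _*ₘ_ : ∀ {n} → Poly F → MatP F n → MatP F n
  (p *ₘ M) i j = p * M i j

  traceP-·ₚ-·ₚ-*ₘ : ∀ {n} p (P Q R : MatP F n) →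
                    traceP F (_·ₚ_ F (_·ₚ_ F (p *ₘ P) Q) R) ≈ p * traceP F (_·ₚ_ F (_·ₚ_ F P Q) R)
  traceP-·ₚ-·ₚ-*ₘ p P Q R = trans
    (sumₚ-cong λ i → trans (sumₚ-cong (entry i)) (sym (*-distribˡ-sumₚ p λ l → _·ₚ_ F P Q i l * R l i)))
    (sym (*-distribˡ-sumₚ p λ i → _·ₚ_ F (_·ₚ_ F P Q) R i i))
    where
      entry : ∀ i l → _·ₚ_ F (p *ₘ P) Q i l * R l i ≈ p * (_·ₚ_ F P Q i l * R l i)
      entry i l = begin
        sumₚ F (λ k → p * P i k * Q k l) * R l i   ≈⟨ *-congʳ (sumₚ-cong λ k → *-assoc p (P i k) (Q k l)) ⟩
        sumₚ F (λ k → p * (P i k * Q k l)) * R l i ≈⟨ *-congʳ (*-distribˡ-sumₚ p λ k → P i k * Q k l) ⟨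
        p * _·ₚ_ F P Q i l * R l i                 ≈⟨ *-assoc p _ _ ⟩
        p * (_·ₚ_ F P Q i l * R l i)               ∎

  liftM-⊕ : ∀ {n m} (A : Mat F n) (B : Mat F m) →
            IsBlockDiagonal (liftM F (_⊕_ F A B)) (liftM F A) (liftM F B)
  liftM-⊕ {n} {m} A B = record
    { upper≈       = λ a b → reflexive (≡.cong (constₚ F) (⊕-upper A B a b))
    ; lower≈       = λ a b → reflexive (≡.cong (constₚ F) (⊕-lower A B a b))
    ; upperRight≈0 = λ a b → constₚ-≈0 (K.reflexive (⊕-upperRight A B (toℕ-↑ˡ-< a m) (≤-toℕ-↑ʳ n b)))
    ; lowerLeft≈0  = λ a b → constₚ-≈0 (K.reflexive (⊕-lowerLeft A B (≤-toℕ-↑ʳ n a) (toℕ-↑ˡ-< b m)))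
    }

  adj-⊕ : ∀ {n m} (A : Mat F n) (B : Mat F m) →
          IsBlockDiagonal (adjP F (xI-C F (_⊕_ F A B)))
                          (charP F B *ₘ adjP F (xI-C F A)) (charP F A *ₘ adjP F (xI-C F B))
  adj-⊕ A B = record
    { upper≈       = adj-⊕-upper A B
    ; lower≈       = adj-⊕-lower A B
    ; upperRight≈0 = adj-⊕-upperRight A B
    ; lowerLeft≈0  = adj-⊕-lowerLeft A B
    }

  dchar-⊕ : ∀ {n m} (A : Mat F n) (B : Mat F m) X →
            dchar F (_⊕_ F A B) X ≈ charP F B * dchar F A (λ a b → X (a ↑ˡ m) (b ↑ˡ m))
                                  + charP F A * dchar F B (λ a b → X (n ↑ʳ a) (n ↑ʳ b))
  dchar-⊕ A B X = trans
    (traceP-·ₚ-blockDiagonal (·ₚ-blockDiagonal (adj-⊕ A B) (liftM-⊕ A B)) (liftM F X))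
    (+-cong (traceP-·ₚ-·ₚ-*ₘ (charP F B) (adjP F (xI-C F A)) (liftM F A) _)
            (traceP-·ₚ-·ₚ-*ₘ (charP F A) (adjP F (xI-C F B)) (liftM F B) _))

  -- The image of ∂char

  Adj·C : ∀ {n} → Mat F n → MatP F n
  Adj·C C = _·ₚ_ F (adjP F (xI-C F C)) (liftM F C)

  dchar-cong : ∀ {n} (C : Mat F n) {X Y : Mat F n} → (∀ i j → X i j K.≈ Y i j) →
               dchar F C X ≈ dchar F C Y
  dchar-cong C X≈Y = sumₚ-cong λ i → sumₚ-cong λ l → *-congˡ {Adj·C C i l} (constₚ-cong (X≈Y l i))

  dchar-zero : ∀ {n} (C : Mat F n) → dchar F C (λ _ _ → K.0#) ≈ 0#
  dchar-zero C = sumₚ-zero λ i → sumₚ-zero λ l → y≈0⇒x*y≈0 (Adj·C C i l) (constₚ-≈0 K.refl)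

  dchar-linear : ∀ {n} (C : Mat F n) a X Y →
                 dchar F C (λ i j → a K.* X i j K.+ Y i j) ≈ constₚ F a * dchar F C X + dchar F C Y
  dchar-linear C a X Y = begin
    sumₚ F (λ i → sumₚ F (λ l → Adj·C C i l * constₚ F (a K.* X l i K.+ Y l i)))
      ≈⟨ sumₚ-cong (λ i → trans (sumₚ-cong (entry i)) (sumₚ-+ (λ l → a′ * fX i l) (fY i))) ⟩
    sumₚ F (λ i → sumₚ F (λ l → a′ * fX i l) + sumₚ F (fY i))
      ≈⟨ sumₚ-cong (λ i → +-congʳ {sumₚ F (fY i)} (*-distribˡ-sumₚ a′ (fX i))) ⟨
    sumₚ F (λ i → a′ * sumₚ F (fX i) + sumₚ F (fY i))
      ≈⟨ sumₚ-+ (λ i → a′ * sumₚ F (fX i)) (λ i → sumₚ F (fY i)) ⟩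
    sumₚ F (λ i → a′ * sumₚ F (fX i)) + dchar F C Y
      ≈⟨ +-congʳ {dchar F C Y} (*-distribˡ-sumₚ a′ (λ i → sumₚ F (fX i))) ⟨
    a′ * dchar F C X + dchar F C Y
      ∎
    where
      a′ = constₚ F a
      fX fY : _ → _ → Poly F
      fX i l = Adj·C C i l * constₚ F (X l i)
      fY i l = Adj·C C i l * constₚ F (Y l i)
      entry : ∀ i l → Adj·C C i l * constₚ F (a K.* X l i K.+ Y l i) ≈ a′ * fX i l + fY i l
      entry i l = begin
        Adj·C C i l * (constₚ F (a K.* X l i) + constₚ F (Y l i))
          ≈⟨ distribˡ (Adj·C C i l) _ _ ⟩
        Adj·C C i l * constₚ F (a K.* X l i) + fY i l
          ≈⟨ +-congʳ {fY i l} (*-congˡ {Adj·C C i l} (constₚ-* a (X l i))) ⟩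
        Adj·C C i l * (a′ * constₚ F (X l i)) + fY i l
          ≈⟨ +-congʳ {fY i l} (x*yz≈y*xz (Adj·C C i l) a′ (constₚ F (X l i))) ⟩
        a′ * fX i l + fY i l
          ∎

  ImDChar-resp : ∀ {n} {C : Mat F n} {p q} → p ≈ q → ImDChar F C p → ImDChar F C q
  ImDChar-resp {C = C} {p} p≈q (X , X↦p) = X , ≋⇒≈ₚ (trans (mk≋ {dchar F C X} {p} X↦p) p≈q)

  ImDChar-scaleₚ-+ : ∀ {n} {C : Mat F n} a {r s} →
                     ImDChar F C r → ImDChar F C s → ImDChar F C (scaleₚ F a r + s)
  ImDChar-scaleₚ-+ {C = C} a {r} {s} (X , X↦r) (Y , Y↦s) = (λ i j → a K.* X i j K.+ Y i j) , ≋⇒≈ₚ (begin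
    dchar F C (λ i j → a K.* X i j K.+ Y i j)
      ≈⟨ dchar-linear C a X Y ⟩
    constₚ F a * dchar F C X + dchar F C Y
      ≈⟨ +-cong (*-congˡ {constₚ F a} (mk≋ {dchar F C X} {r} X↦r)) (mk≋ {dchar F C Y} {s} Y↦s) ⟩
    constₚ F a * r + s
      ≈⟨ +-congʳ {s} (scaleₚ≈constₚ-* a r) ⟨
    scaleₚ F a r + s
      ∎)

  ImDChar-linComb : ∀ {n} (C : Mat F n) xs →
                    All.All (λ cs → ImDChar F C (proj₂ cs)) xs → ImDChar F C (linComb F xs)
  ImDChar-linComb C []             []          = (λ _ _ → K.0#) , ≋⇒≈ₚ (dchar-zero C)
  ImDChar-linComb C ((a , r) ∷ xs) (r∈ ∷ xs∈) =
    ImDChar-scaleₚ-+ a {r} {linComb F xs} r∈ (ImDChar-linComb C xs xs∈)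

  scaledBlockImages : ∀ {n m} → Mat F n → Mat F m → Poly F → Set (c ⊔ ℓ)
  scaledBlockImages A B r = ScaledBy F (charP F B) (ImDChar F A) r ⊎ ScaledBy F (charP F A) (ImDChar F B) r

  module _ {n m} (A : Mat F n) (B : Mat F m) where
    private
      O : ∀ {k} → Mat F k
      O _ _ = K.0#

    dchar-⊕-upperEmbedding : ∀ Y → dchar F (_⊕_ F A B) (_⊕_ F Y (O {m})) ≈ charP F B * dchar F A Y
    dchar-⊕-upperEmbedding Y = begin
      dchar F (_⊕_ F A B) (_⊕_ F Y O)
        ≈⟨ dchar-⊕ A B (_⊕_ F Y O) ⟩
      charP F B * dchar F A (λ a b → _⊕_ F Y O (a ↑ˡ m) (b ↑ˡ m))
        + charP F A * dchar F B (λ a b → _⊕_ F Y O (n ↑ʳ a) (n ↑ʳ b))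
        ≈⟨ +-cong (*-congˡ {charP F B} (dchar-cong A λ a b → K.reflexive (⊕-upper Y (O {m}) a b)))
                  (y≈0⇒x*y≈0 (charP F A)
                    (trans (dchar-cong B λ a b → K.reflexive (⊕-lower Y (O {m}) a b)) (dchar-zero B))) ⟩
      charP F B * dchar F A Y + 0#
        ≈⟨ +-identityʳ _ ⟩
      charP F B * dchar F A Y
        ∎

    dchar-⊕-lowerEmbedding : ∀ Y → dchar F (_⊕_ F A B) (_⊕_ F (O {n}) Y) ≈ charP F A * dchar F B Y
    dchar-⊕-lowerEmbedding Y = begin
      dchar F (_⊕_ F A B) (_⊕_ F O Y)
        ≈⟨ dchar-⊕ A B (_⊕_ F O Y) ⟩
      charP F B * dchar F A (λ a b → _⊕_ F O Y (a ↑ˡ m) (b ↑ˡ m))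
        + charP F A * dchar F B (λ a b → _⊕_ F O Y (n ↑ʳ a) (n ↑ʳ b))
        ≈⟨ +-cong (y≈0⇒x*y≈0 (charP F B)
                    (trans (dchar-cong A λ a b → K.reflexive (⊕-upper (O {n}) Y a b)) (dchar-zero A)))
                  (*-congˡ {charP F A} (dchar-cong B λ a b → K.reflexive (⊕-lower (O {n}) Y a b))) ⟩
      0# + charP F A * dchar F B Y
        ≈⟨ +-identityˡ _ ⟩
      charP F A * dchar F B Y
        ∎

    scaledBlockImages⊆ImDChar-⊕ : ∀ {r} → scaledBlockImages A B r → ImDChar F (_⊕_ F A B) r
    scaledBlockImages⊆ImDChar-⊕ {r} (inj₁ (f , (Y , Y↦f) , r≈)) = _⊕_ F Y O , ≋⇒≈ₚ (begin
      dchar F (_⊕_ F A B) (_⊕_ F Y O) ≈⟨ dchar-⊕-upperEmbedding Y ⟩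
      charP F B * dchar F A Y         ≈⟨ *-congˡ {charP F B} (mk≋ {dchar F A Y} {f} Y↦f) ⟩
      charP F B * f                   ≈⟨ mk≋ {r} {charP F B * f} r≈ ⟨
      r                               ∎)
    scaledBlockImages⊆ImDChar-⊕ {r} (inj₂ (f , (Y , Y↦f) , r≈)) = _⊕_ F O Y , ≋⇒≈ₚ (begin
      dchar F (_⊕_ F A B) (_⊕_ F O Y) ≈⟨ dchar-⊕-lowerEmbedding Y ⟩
      charP F A * dchar F B Y         ≈⟨ *-congˡ {charP F A} (mk≋ {dchar F B Y} {f} Y↦f) ⟩
      charP F A * f                   ≈⟨ mk≋ {r} {charP F A * f} r≈ ⟨
      r                               ∎)

    ImDChar-⊕⊆span : ∀ {p} → ImDChar F (_⊕_ F A B) p → Span F (scaledBlockImages A B) p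
    ImDChar-⊕⊆span {p} (X , X↦p) =
      (K.1# , u) ∷ (K.1# , v) ∷ [] ,
      inj₁ (_ , (X₁₁ , λ _ → K.refl) , λ _ → K.refl) ∷ inj₂ (_ , (X₂₂ , λ _ → K.refl) , λ _ → K.refl) ∷ [] ,
      ≋⇒≈ₚ (begin
        p                                        ≈⟨ mk≋ {dchar F (_⊕_ F A B) X} {p} X↦p ⟨
        dchar F (_⊕_ F A B) X                    ≈⟨ dchar-⊕ A B X ⟩
        u + v                                    ≈⟨ +-cong (scaleₚ-1 u)
                                                      (trans (+-identityʳ (scaleₚ F K.1# v)) (scaleₚ-1 v)) ⟨
        scaleₚ F K.1# u + (scaleₚ F K.1# v + 0#) ∎)
      where
        X₁₁ : Mat F n
        X₁₁ a b = X (a ↑ˡ m) (b ↑ˡ m)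
        X₂₂ : Mat F m
        X₂₂ a b = X (n ↑ʳ a) (n ↑ʳ b)
        u v : Poly F
        u = charP F B * dchar F A X₁₁
        v = charP F A * dchar F B X₂₂

    span⊆ImDChar-⊕ : ∀ {p} → Span F (scaledBlockImages A B) p → ImDChar F (_⊕_ F A B) p
    span⊆ImDChar-⊕ {p} (xs , xs⊆ , p≈) = ImDChar-resp (sym (mk≋ {p} {linComb F xs} p≈))
      (ImDChar-linComb (_⊕_ F A B) xs (All.map (λ {cs} → scaledBlockImages⊆ImDChar-⊕ {proj₂ cs}) xs⊆))

open Matrices

lemma6p1 : ∀ {c ℓ : Level} (F : CommutativeRing c ℓ) → IsFiniteFieldOddChar F →
    (n m : ℕ) (A : Mat F n) (B : Mat F m) → Invertible F A → Invertible F B →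
    ∀ (p : Poly F) →
      (ImDChar F (_⊕_ F A B) p →
        Span F (λ r → ScaledBy F (charP F B) (ImDChar F A) r ⊎ ScaledBy F (charP F A) (ImDChar F B) r) p)
      ×
      (Span F (λ r → ScaledBy F (charP F B) (ImDChar F A) r ⊎ ScaledBy F (charP F A) (ImDChar F B) r) p →
        ImDChar F (_⊕_ F A B) p)
lemma6p1 F _ n m A B _ _ p = ImDChar-⊕⊆span F A B {p} , span⊆ImDChar-⊕ F A B {p}
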